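{- Let $G$ be a $c$-colored graph. Then the relation $\sim$ on $V(G)$ is an equivalence relation.
   Context: A $c$-colored graph is a simple graph with $E=E_1\sqcup\dots\sqcup E_c$. For vertex $v$ and color $i$, $N^i(v)=\{u:\{u,v\}\in E_i\}$ and $N^i[v]=N^i(v)\cup\{v\}$. For vertices $u,v$, $u\sim v$ holds if either (a) $N^i[u]=N^i[v]$ for some color $i$ and $N^j(u)=N^j(v)$ for every other color $j\in[c]\setminus\{i\}$, or (b) $N^j(u)=N^j(v)$ for every color $j\in[c]$. -}

module Defs where

open import Data.Nat using (ℕ)
open import Data.Fin using (Fin)
open import Data.Bool using (Bool; true; false)
open import Data.Product using (_×_; Σ)
open import Data.Sum using (_⊎_)
open import Relation.Binary.PropositionalEquality using (_≡_; _≢_)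
open import Relation.Nullary using (¬_)
open import Function.Bundles using (_⇔_)

record ColoredGraph (c n : ℕ) : Set where
  field
    edge      : Fin c → Fin n → Fin n → Bool
    symmetric : ∀ i u v → edge i u v ≡ edge i v u
    loopless  : ∀ i v → edge i v v ≡ false
    disjoint  : ∀ i j u v → i ≢ j → edge i u v ≡ true → edge j u v ≡ false

module _ {c n : ℕ} (G : ColoredGraph c n) where
  open ColoredGraph G

  InN : Fin c → Fin n → Fin n → Set
  InN i v w = edge i v w ≡ true

  InN[] : Fin c → Fin n → Fin n → Set
  InN[] i v w = (w ≡ v) ⊎ (edge i v w ≡ true)

  OpenEq : Fin c → Fin n → Fin n → Set
  OpenEq i u v = ∀ w → InN i u w ⇔ InN i v w

  ClosedEq : Fin c → Fin n → Fin n → Set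
  ClosedEq i u v = ∀ w → InN[] i u w ⇔ InN[] i v w

  _∼_ : Fin n → Fin n → Set
  u ∼ v = (Σ (Fin c) λ i → ClosedEq i u v × (∀ j → j ≢ i → OpenEq j u v))
        ⊎ (∀ j → OpenEq j u v)

{-# OPTIONS --safe #-}
module Submission where

open import Defs
open import Data.Nat using (ℕ)
open import Data.Fin using (Fin; _≟_)
open import Data.Product using (_,_)
open import Data.Sum using (inj₁; inj₂)
open import Data.Empty using (⊥-elim)
open import Relation.Nullary using (¬_; yes; no)
open import Relation.Binary.PropositionalEquality using (_≡_; _≢_; refl; sym; trans; ≢-sym)
open import Relation.Binary.Structures using (IsEquivalence)
open import Function.Bundles using (_⇔_; Equivalence)
open import Function.Properties.Equivalence using (⇔-isEquivalence)

-- Twins of one colour come in two kinds: closed twins u ≠ v of colour i are i-adjacent,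
-- open twins are not.  A chain u ∼ v ∼ w through distinct vertices that mixes a closed
-- i-twin pair u, v with an open i-twin pair v, w forces v, w to be i-adjacent, which
-- contradicts either looplessness (if v, w are open i-twins) or colour disjointness
-- (if they are closed j-twins for j ≠ i).  So transitivity only ever composes twins of
-- the same kind and colour, where it is transitivity of equality of neighbourhoods.

module ⇔ {ℓ} = IsEquivalence (⇔-isEquivalence {ℓ})

sameFibres-isEquivalence : {A B : Set} (F : A → B → Set) →
                           IsEquivalence (λ u v → ∀ w → F u w ⇔ F v w)
sameFibres-isEquivalence F = record
  { refl  = λ w → ⇔.refl
  ; sym   = λ u≈v w → ⇔.sym (u≈v w)
  ; trans = λ u≈v v≈w w → ⇔.trans (u≈v w) (v≈w w)
  }

module _ {c n : ℕ} (G : ColoredGraph c n) where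
  open ColoredGraph G
  open Equivalence

  module OpenEq {i} = IsEquivalence (sameFibres-isEquivalence (InN G i))
  module ClosedEq {i} = IsEquivalence (sameFibres-isEquivalence (InN[] G i))

  closedTwins-adjacent : ∀ {i u v} → ClosedEq G i u v → u ≢ v → InN G i u v
  closedTwins-adjacent {v = v} u≈v u≢v with from (u≈v v) (inj₁ refl)
  ... | inj₁ v≡u = ⊥-elim (u≢v (sym v≡u))
  ... | inj₂ uv  = uv

  openTwins-nonadjacent : ∀ {i v w} → OpenEq G i v w → ¬ InN G i v w
  openTwins-nonadjacent {i} {w = w} v≈w vw with trans (sym (loopless i w)) (to (v≈w w) vw)
  ... | ()

  closedTwin-openTwin-adjacent : ∀ {i u v w} → ClosedEq G i u v → OpenEq G i v w →
                                 u ≢ v → v ≢ w → InN G i v w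
  closedTwin-openTwin-adjacent {i} {u} {v} {w} u≈v v≈w u≢v v≢w
    with to (u≈v w) (inj₂ (trans (symmetric i u w) wu))
    where
      wu : InN G i w u
      wu = to (v≈w u) (trans (symmetric i v u) (closedTwins-adjacent u≈v u≢v))
  ... | inj₁ w≡v = ⊥-elim (v≢w (sym w≡v))
  ... | inj₂ vw  = vw

  closedTwins-differentColour : ∀ {i j v w} → i ≢ j → ClosedEq G j v w → v ≢ w →
                                ¬ InN G i v w
  closedTwins-differentColour {i} {j} {v} {w} i≢j v≈w v≢w vw
    with trans (sym (disjoint i j v w i≢j vw)) (closedTwins-adjacent v≈w v≢w)
  ... | ()

  ∼-refl : ∀ {u} → _∼_ G u u
  ∼-refl = inj₂ (λ j → OpenEq.refl)

  ∼-sym : ∀ {u v} → _∼_ G u v → _∼_ G v u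
  ∼-sym (inj₁ (i , u≈v , rest)) = inj₁ (i , ClosedEq.sym u≈v , λ j j≢i → OpenEq.sym (rest j j≢i))
  ∼-sym (inj₂ u≈v)              = inj₂ (λ j → OpenEq.sym (u≈v j))

  ∼-trans-distinct : ∀ {u v w} → u ≢ v → v ≢ w → _∼_ G u v → _∼_ G v w → _∼_ G u w
  ∼-trans-distinct _ _ (inj₂ u≈v) (inj₂ v≈w) = inj₂ (λ j → OpenEq.trans (u≈v j) (v≈w j))
  ∼-trans-distinct u≢v v≢w (inj₁ (i , u≈v , _)) (inj₂ v≈w) =
    ⊥-elim (openTwins-nonadjacent (v≈w i) (closedTwin-openTwin-adjacent u≈v (v≈w i) u≢v v≢w))
  ∼-trans-distinct u≢v v≢w (inj₂ u≈v) (inj₁ (i , v≈w , _)) =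
    ⊥-elim (openTwins-nonadjacent (OpenEq.sym (u≈v i))
             (closedTwin-openTwin-adjacent (ClosedEq.sym v≈w) (OpenEq.sym (u≈v i))
                                           (≢-sym v≢w) (≢-sym u≢v)))
  ∼-trans-distinct u≢v v≢w (inj₁ (i , u≈v , restᵤ)) (inj₁ (j , v≈w , restᵥ)) with i ≟ j
  ... | yes refl = inj₁ (i , ClosedEq.trans u≈v v≈w ,
                         λ k k≢i → OpenEq.trans (restᵤ k k≢i) (restᵥ k k≢i))
  ... | no i≢j   = ⊥-elim (closedTwins-differentColour i≢j v≈w v≢w
                             (closedTwin-openTwin-adjacent u≈v (restᵥ i i≢j) u≢v v≢w))

  ∼-trans : ∀ {u v w} → _∼_ G u v → _∼_ G v w → _∼_ G u w
  ∼-trans {u} {v} {w} u∼v v∼w with u ≟ v | v ≟ w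
  ... | yes refl | _        = v∼w
  ... | no _     | yes refl = u∼v
  ... | no u≢v   | no v≢w   = ∼-trans-distinct u≢v v≢w u∼v v∼w

proposition14 : (c n : ℕ) (G : ColoredGraph c n) → IsEquivalence (_∼_ G)
proposition14 c n G = record { refl = ∼-refl G ; sym = ∼-sym G ; trans = ∼-trans G }
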